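{- Let $\Gamma=(V,L)$ be a connected oriented graph (no edge with equal endpoints, at most one edge between two vertices), $\Delta_\Gamma=\{x_e:=e_{f(e)}-e_{i(e)}:e\in L\}\subset\mathbb R^V$, and $V_\Gamma=\mathrm{span}\,\Delta_\Gamma$ (the vectors of $\mathbb R^V$ with coordinate sum $0$), of dimension $r=|V|-1$. Fix a total order on $L$ (hence on $\Delta_\Gamma$) and let $a$ be the minimal edge. Call $S\subseteq\Delta_\Gamma$ complete if $\mathrm{span}(S)\cap\Delta_\Gamma=S$. A proper flag is a chain $\Delta_\Gamma=A_1\supsetneq A_2\supsetneq\cdots\supsetneq A_r$ of nonempty complete subsets, maximal among such chains, such that the minimal elements $\min A_1,\dots,\min A_r$ form a basis of $V_\Gamma$; the flag is adapted to $u\in V_\Gamma$ if $u=\sum_{i=1}^r c_i\min A_i$ with all $c_i>0$. Suppose $A_2$ is the edge set of a subgraph $\Lambda$ which has two connected components with vertex sets $V_A,V_B$, $V=V_A\sqcup V_B$, obtained from $\Gamma$ by deleting a set of edges each joining the two components, with $a\notin\Lambda$ and the final vertex $f(a)\in V_A$. If $\Delta_\Gamma=A_1\supsetneq A_2\supsetneq\cdots\supsetneq A_r$ is a proper flag adapted to $u=(u_w)_{w\in V}\in V_\Gamma$, then $\sum_{w\in V_A}u_w\ge 0$. -}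

module Defs where

open import Level using (Level; _⊔_) renaming (suc to lsuc)
open import Data.Nat using (ℕ; suc) renaming (zero to ℕzero)
open import Data.Bool using (Bool; true; false; if_then_else_)
open import Data.Fin using (Fin; zero; suc; _≟_; toℕ) renaming (_≤_ to _≤ᶠ_)
open import Data.Fin.Subset using (Subset; _∈_; _∉_; _⊂_; Nonempty; ⊤)
open import Data.Vec using (lookup)
open import Data.Product using (Σ; ∃; _×_; _,_)
open import Data.Sum using (_⊎_)
open import Relation.Nullary using (¬_; yes; no)
open import Relation.Binary using (Rel; IsStrictTotalOrder)
open import Relation.Binary.PropositionalEquality using (_≡_; _≢_)
open import Algebra.Bundles using (CommutativeRing)

-- An ordered field (ℝ is an instance).  The paper works over ℝ; agda-stdlib
-- has no reals, so everything is stated over an arbitrary ordered field.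
record OrderedField (c ℓ : Level) : Set (lsuc (c ⊔ ℓ)) where
  field
    commutativeRing : CommutativeRing c ℓ
  open CommutativeRing commutativeRing public
  infix 4 _<_ _≤_
  field
    _<_                  : Rel Carrier ℓ
    <-isStrictTotalOrder : IsStrictTotalOrder _≈_ _<_
    +-mono-<             : ∀ {x y} z → x < y → (x + z) < (y + z)
    *-pos                : ∀ {x y} → 0# < x → 0# < y → 0# < (x * y)
    0≉1                  : ¬ (0# ≈ 1#)
    inverse              : ∀ x → ¬ (x ≈ 0#) → ∃ λ y → (x * y) ≈ 1#

  _≤_ : Rel Carrier ℓ
  x ≤ y = (x < y) ⊎ (x ≈ y)

-- An oriented graph with vertex set Fin n and edge set Fin m.
-- The total order on edges is the natural order of Fin m.
record OrientedGraph (n m : ℕ) : Set where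
  field
    init fin : Fin m → Fin n
    loopless : ∀ e → init e ≢ fin e
    simple   : ∀ e e' → ((init e ≡ init e' × fin e ≡ fin e')
                         ⊎ (init e ≡ fin e' × fin e ≡ init e')) → e ≡ e'

data Reach {n m : ℕ} (Γ : OrientedGraph n m) (P : Fin m → Set) : Fin n → Fin n → Set where
  here  : ∀ {v} → Reach Γ P v v
  fwd   : ∀ {v} e → P e → Reach Γ P (OrientedGraph.fin Γ e) v → Reach Γ P (OrientedGraph.init Γ e) v
  bwd   : ∀ {v} e → P e → Reach Γ P (OrientedGraph.init Γ e) v → Reach Γ P (OrientedGraph.fin Γ e) v

module Graph {c ℓ : Level} (K : OrderedField c ℓ) {n m : ℕ} (Γ : OrientedGraph n m) where
  open OrderedField K using (Carrier; _≈_; _+_; _*_; _-_; 0#; 1#; _<_)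
  open OrientedGraph Γ

  sumK : ∀ {k} → (Fin k → Carrier) → Carrier
  sumK {ℕzero}  f = 0#
  sumK {suc k} f = f zero + sumK (λ i → f (suc i))

  Vect : Set c
  Vect = Fin n → Carrier

  ind : Fin n → Vect
  ind v w with v ≟ w
  ... | yes _ = 1#
  ... | no  _ = 0#

  x : Fin m → Vect
  x e w = ind (fin e) w - ind (init e) w

  InSpan : Subset m → Vect → Set (c ⊔ ℓ)
  InSpan S v = Σ (Fin m → Carrier) λ a →
    ∀ w → v w ≈ sumK (λ e → if lookup S e then a e * x e w else 0#)

  InVΓ : Vect → Set (c ⊔ ℓ)
  InVΓ = InSpan ⊤

  Complete : Subset m → Set (c ⊔ ℓ)
  Complete S = ∀ e → (InSpan S (x e) → e ∈ S) × (e ∈ S → InSpan S (x e))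

  Connected : Set
  Connected = ∀ v w → Reach Γ (λ _ → Data.Unit.⊤) v w
    where import Data.Unit

  IsMin : Fin m → Subset m → Set
  IsMin e S = e ∈ S × (∀ e' → e' ∈ S → e ≤ᶠ e')

  IsBasis : ∀ {r} → (Fin r → Vect) → Set (c ⊔ ℓ)
  IsBasis {r} b =
      (∀ i → InVΓ (b i))
    × (∀ (a : Fin r → Carrier) → (∀ w → sumK (λ i → a i * b i w) ≈ 0#) → ∀ i → a i ≈ 0#)
    × (∀ v → InVΓ v → Σ (Fin r → Carrier) λ a → ∀ w → v w ≈ sumK (λ i → a i * b i w))

  -- Proper flag A_1 ⊋ … ⊋ A_r (indexed by Fin r, A_1 = A at index 0),
  -- with mins i = min A_i.
  IsProperFlag : ∀ {r} → (Fin r → Subset m) → (Fin r → Fin m) → Set (c ⊔ ℓ)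
  IsProperFlag {r} A mins =
      (∀ i → toℕ i ≡ 0 → A i ≡ ⊤)
    × (∀ i → Complete (A i) × Nonempty (A i))
    × (∀ i j → toℕ j ≡ suc (toℕ i) → A j ⊂ A i)
    × (∀ i j → toℕ j ≡ suc (toℕ i) →
         ¬ (Σ (Subset m) λ B → Complete B × Nonempty B × A j ⊂ B × B ⊂ A i))
    × (∀ i → suc (toℕ i) ≡ r →
         ¬ (Σ (Subset m) λ B → Complete B × Nonempty B × B ⊂ A i))
    × (∀ i → IsMin (mins i) (A i))
    × IsBasis (λ i → x (mins i))

  Adapted : ∀ {r} → (Fin r → Fin m) → Vect → Set (c ⊔ ℓ)
  Adapted {r} mins u = Σ (Fin r → Carrier) λ a →
    (∀ i → 0# < a i) × (∀ w → u w ≈ sumK (λ i → a i * x (mins i) w))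

-- Pairing with the indicator weight of V_A is a linear functional σ with
-- σ(x_e) = [f(e) ∈ V_A] − [i(e) ∈ V_A].  Every A_i with i ≥ 2 lies in A_2, whose
-- edges never join the two components, so σ vanishes on min A_i for i ≥ 2; while
-- min A_1 = a runs from V_B into V_A, so σ(min A_1) = 1.  Hence σ(u) = c_1 > 0.
module Submission where

open import Defs
open import Data.Nat using (ℕ; suc)
open import Data.Bool using (Bool; true; false; if_then_else_)
open import Data.Fin using (Fin; zero; toℕ)
open import Data.Fin.Subset using (Subset; _∈_; _∉_)
open import Data.Product using (Σ; _×_)
open import Relation.Binary.PropositionalEquality using (_≡_)

open import Level using (Level)
import Data.Nat as ℕ
open import Data.Nat.Properties using (m≤n⇒m<n∨m≡n; <⇒≤; n≤0⇒n≡0)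
import Data.Fin as Fin
open import Data.Fin using (_≤_; fromℕ<; punchIn)
open import Data.Fin.Properties using (toℕ-injective; toℕ-fromℕ<; toℕ<n; punchInᵢ≢i)
open import Data.Fin.Subset using (_⊆_; _⊂_)
open import Data.Fin.Subset.Properties using (∈⊤; ⊆-reflexive)
open import Data.Vec.Functional using (Vector; removeAt; replicate)
open import Data.Product using (_,_; proj₁; proj₂)
open import Data.Sum using (inj₁; inj₂)
open import Function using (_∘_)
open import Relation.Nullary using (yes; no; contradiction)
open import Relation.Binary using (IsStrictTotalOrder)
open import Relation.Binary.PropositionalEquality as ≡ using (_≢_)
open import Algebra.Bundles using (CommutativeMonoid)
import Algebra.Properties.CommutativeMonoid.Sum as MonoidSum
import Algebra.Properties.Semiring.Sum as SemiringSum
import Algebra.Properties.Ring as RingProperties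
import Algebra.Properties.CommutativeSemigroup as CommutativeSemigroupProperties
import Relation.Binary.Reasoning.Setoid as SetoidReasoning

module _ {a ℓ : Level} (M : CommutativeMonoid a ℓ) where
  open CommutativeMonoid M
  open MonoidSum M
  open SetoidReasoning setoid

  sum-concentrated : ∀ {n} (t : Vector Carrier n) p → (∀ w → w ≢ p → t w ≈ ε) → sum t ≈ t p
  sum-concentrated {suc n} t p t≈ε = begin
    sum t                        ≈⟨ sum-remove {i = p} t ⟩
    t p ∙ sum (removeAt t p)     ≈⟨ ∙-congˡ (sum-cong-≋ {n} (λ j → t≈ε (punchIn p j) (punchInᵢ≢i p j))) ⟩
    t p ∙ sum (replicate n ε)    ≈⟨ ∙-congˡ (sum-replicate-zero n) ⟩
    t p ∙ ε                      ≈⟨ identityʳ (t p) ⟩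
    t p                          ∎

module _ {m r : ℕ} (A : Fin r → Subset m)
         (descending : ∀ i j → toℕ j ≡ suc (toℕ i) → A j ⊂ A i) where

  descending⇒antitone : ∀ {i j} → i ≤ j → A j ⊆ A i
  descending⇒antitone {i} {j} = go (toℕ j) ≡.refl
    where
    go : ∀ k {j} → toℕ j ≡ k → toℕ i ℕ.≤ k → A j ⊆ A i
    go k j≡k i≤k with m≤n⇒m<n∨m≡n i≤k
    ... | inj₂ i≡k = ⊆-reflexive (≡.cong A (toℕ-injective (≡.trans j≡k (≡.sym i≡k))))
    go (suc k) {j} j≡k _ | inj₁ (ℕ.s≤s i≤k) =
      go k (toℕ-fromℕ< k<r) i≤k ∘ proj₁ (descending _ j (≡.trans j≡k (≡.cong suc (≡.sym (toℕ-fromℕ< k<r)))))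
      where
      k<r : k ℕ.< r
      k<r = <⇒≤ (≡.subst (ℕ._< r) j≡k (toℕ<n j))

module Pairing {c ℓ} (K : OrderedField c ℓ) {n m : ℕ} (Γ : OrientedGraph n m) where
  open OrderedField K hiding (zero)
  open Graph K Γ
  open OrientedGraph Γ
  open SemiringSum semiring
  open RingProperties ring using (-1*x≈-x; x[y-z]≈xy-xz; -0#≈0#)
  open CommutativeSemigroupProperties *-commutativeSemigroup using (x∙yz≈y∙xz)
  open SetoidReasoning setoid

  sumK≡sum : ∀ {k} (f : Fin k → Carrier) → sumK f ≡ sum f
  sumK≡sum {ℕ.zero} f = ≡.refl
  sumK≡sum {suc k}  f = ≡.cong (f zero +_) (sumK≡sum (f ∘ Fin.suc))

  sum-neg : ∀ {k} (f : Fin k → Carrier) → sum (λ w → - f w) ≈ - sum f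
  sum-neg f = begin
    sum (λ w → - f w)          ≈⟨ sum-cong-≋ (λ w → sym (-1*x≈-x (f w))) ⟩
    sum (λ w → - 1# * f w)     ≈⟨ *-distribˡ-sum (- 1#) f ⟨
    - 1# * sum f               ≈⟨ -1*x≈-x (sum f) ⟩
    - sum f                    ∎

  infix 7 _·_
  _·_ : Vect → Vect → Carrier
  t · v = sum (λ w → t w * v w)

  ·-congʳ : ∀ t {u v} → (∀ w → u w ≈ v w) → t · u ≈ t · v
  ·-congʳ t u≈v = sum-cong-≋ (λ w → *-congˡ (u≈v w))

  ·-linear : ∀ {k} t (a : Fin k → Carrier) (y : Fin k → Vect) →
             t · (λ w → sumK (λ i → a i * y i w)) ≈ sumK (λ i → a i * (t · y i))
  ·-linear {k} t a y = begin
    sum (λ w → t w * sumK (λ i → a i * y i w))   ≈⟨ sum-cong-≋ {n} (λ w → *-congˡ (reflexive (sumK≡sum (λ i → a i * y i w)))) ⟩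
    sum (λ w → t w * sum (λ i → a i * y i w))    ≈⟨ sum-cong-≋ (λ w → *-distribˡ-sum (t w) (λ i → a i * y i w)) ⟩
    sum (λ w → sum (λ i → t w * (a i * y i w)))  ≈⟨ sum-cong-≋ (λ w → sum-cong-≋ (λ i → x∙yz≈y∙xz (t w) (a i) (y i w))) ⟩
    sum (λ w → sum (λ i → a i * (t w * y i w)))  ≈⟨ ∑-comm {n} {k} (λ w i → a i * (t w * y i w)) ⟩
    sum (λ i → sum (λ w → a i * (t w * y i w)))  ≈⟨ sum-cong-≋ (λ i → *-distribˡ-sum (a i) (λ w → t w * y i w)) ⟨
    sum (λ i → a i * (t · y i))                  ≈⟨ reflexive (sumK≡sum (λ i → a i * (t · y i))) ⟨
    sumK (λ i → a i * (t · y i))                 ∎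

  ·-sub : ∀ t u v → t · (λ w → u w - v w) ≈ t · u - t · v
  ·-sub t u v = begin
    sum (λ w → t w * (u w - v w))           ≈⟨ sum-cong-≋ (λ w → x[y-z]≈xy-xz (t w) (u w) (v w)) ⟩
    sum (λ w → t w * u w - t w * v w)       ≈⟨ ∑-distrib-+ (λ w → t w * u w) (λ w → - (t w * v w)) ⟩
    t · u + sum (λ w → - (t w * v w))       ≈⟨ +-congˡ (sum-neg (λ w → t w * v w)) ⟩
    t · u - t · v                           ∎

  ind-self : ∀ p → ind p p ≈ 1#
  ind-self p with p Fin.≟ p
  ... | yes _   = refl
  ... | no p≢p  = contradiction ≡.refl p≢p

  ind-other : ∀ p w → w ≢ p → ind p w ≈ 0#
  ind-other p w w≢p with p Fin.≟ w
  ... | yes p≡w = contradiction (≡.sym p≡w) w≢p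
  ... | no _    = refl

  ·-ind : ∀ t p → t · ind p ≈ t p
  ·-ind t p = begin
    t · ind p      ≈⟨ sum-concentrated +-commutativeMonoid (λ w → t w * ind p w) p
                        (λ w w≢p → trans (*-congˡ (ind-other p w w≢p)) (zeroʳ (t w))) ⟩
    t p * ind p p  ≈⟨ *-congˡ (ind-self p) ⟩
    t p * 1#       ≈⟨ *-identityʳ (t p) ⟩
    t p            ∎

  ·-x : ∀ t e → t · x e ≈ t (fin e) - t (init e)
  ·-x t e = trans (·-sub t (ind (fin e)) (ind (init e))) (+-cong (·-ind t (fin e)) (-‿cong (·-ind t (init e))))

  ·-dual-coefficient : ∀ {k} t (a : Fin k → Carrier) (y : Fin k → Vect) p →
                       t · y p ≈ 1# → (∀ i → i ≢ p → t · y i ≈ 0#) →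
                       t · (λ w → sumK (λ i → a i * y i w)) ≈ a p
  ·-dual-coefficient t a y p t·yp≈1 t·yi≈0 = begin
    t · (λ w → sumK (λ i → a i * y i w))  ≈⟨ ·-linear t a y ⟩
    sumK (λ i → a i * (t · y i))          ≡⟨ sumK≡sum (λ i → a i * (t · y i)) ⟩
    sum (λ i → a i * (t · y i))           ≈⟨ sum-concentrated +-commutativeMonoid (λ i → a i * (t · y i)) p
                                               (λ i i≢p → trans (*-congˡ (t·yi≈0 i i≢p)) (zeroʳ (a i))) ⟩
    a p * (t · y p)                       ≈⟨ *-congˡ t·yp≈1 ⟩
    a p * 1#                              ≈⟨ *-identityʳ (a p) ⟩
    a p                                   ∎

  χ : Bool → Carrier
  χ true  = 1#
  χ false = 0#

  if-then-0≈χ* : ∀ β y → (if β then y else 0#) ≈ χ β * y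
  if-then-0≈χ* true  y = sym (*-identityˡ y)
  if-then-0≈χ* false y = sym (zeroˡ y)

  module _ (side : Fin n → Bool) where

    sideSum≈χ·  : ∀ v → sumK (λ w → if side w then v w else 0#) ≈ (χ ∘ side) · v
    sideSum≈χ· v = trans (reflexive (sumK≡sum (λ w → if side w then v w else 0#)))
                         (sum-cong-≋ (λ w → if-then-0≈χ* (side w) (v w)))

    χ·x-sameSide : ∀ e → side (init e) ≡ side (fin e) → (χ ∘ side) · x e ≈ 0#
    χ·x-sameSide e same = trans (·-x (χ ∘ side) e) (trans (+-congˡ (-‿cong (reflexive (≡.cong χ same)))) (-‿inverseʳ _))

    χ·x-entering : ∀ e → side (init e) ≢ true → side (fin e) ≡ true → (χ ∘ side) · x e ≈ 1#
    χ·x-entering e init∉ fin∈ = trans (·-x (χ ∘ side) e) (χ-entering (side (fin e)) (side (init e)) fin∈ init∉)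
      where
      χ-entering : ∀ γ β → γ ≡ true → β ≢ true → χ γ - χ β ≈ 1#
      χ-entering true true  _ β≢true = contradiction ≡.refl β≢true
      χ-entering true false _ _      = trans (+-congˡ -0#≈0#) (+-identityʳ 1#)

mainTheorem7 : ∀ {c ℓ} (K : OrderedField c ℓ) (r m : ℕ) (Γ : OrientedGraph (suc r) (suc m)) →
  let open OrientedGraph Γ
      open Graph K Γ
  in Connected →
     (A : Fin r → Subset (suc m)) (mins : Fin r → Fin (suc m)) →
     IsProperFlag A mins →
     (u : Fin (suc r) → OrderedField.Carrier K) → Adapted mins u →
     (side : Fin (suc r) → Bool) →
     (i₂ : Fin r) → toℕ i₂ ≡ 1 →
     (∀ e → (e ∈ A i₂ → side (init e) ≡ side (fin e)) × (side (init e) ≡ side (fin e) → e ∈ A i₂)) →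
     Σ (Fin (suc r)) (λ w → side w ≡ true) →
     Σ (Fin (suc r)) (λ w → side w ≡ false) →
     (∀ v w → side v ≡ side w → Reach Γ (λ e → e ∈ A i₂) v w) →
     zero ∉ A i₂ →
     side (fin zero) ≡ true →
     OrderedField._≤_ K (OrderedField.0# K) (sumK (λ w → if side w then u w else OrderedField.0# K))
mainTheorem7 K ℕ.zero m Γ _ A mins _ u _ side () _
mainTheorem7 K (suc r) m Γ _ A mins (A₁≡⊤ , _ , descending , _ , _ , isMin , _) u (c , c>0 , u≈) side
             i₂ i₂≡1 A₂-sameSide _ _ _ a∉A₂ fa∈VA =
  inj₁ (IsStrictTotalOrder.<-respʳ-≈ <-isStrictTotalOrder (sym σu≈c₁) (c>0 zero))
  where
  open OrderedField K hiding (zero)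
  open Graph K Γ
  open OrientedGraph Γ
  open Pairing K Γ

  σ : Vect
  σ = χ ∘ side

  mins₁≡a : mins zero ≡ zero
  mins₁≡a = toℕ-injective (n≤0⇒n≡0 (proj₂ (isMin zero) zero (≡.subst (zero ∈_) (≡.sym (A₁≡⊤ zero ≡.refl)) ∈⊤)))

  σ·min₁ : σ · x (mins zero) ≈ 1#
  σ·min₁ rewrite mins₁≡a = χ·x-entering side zero ia∉VA fa∈VA
    where
    ia∉VA : side (init zero) ≢ true
    ia∉VA ia∈VA = a∉A₂ (proj₂ (A₂-sameSide zero) (≡.trans ia∈VA (≡.sym fa∈VA)))

  σ·minᵢ : ∀ i → i ≢ zero → σ · x (mins i) ≈ 0#
  σ·minᵢ zero      i≢0 = contradiction ≡.refl i≢0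
  σ·minᵢ (Fin.suc i) _ = χ·x-sameSide side _ (proj₁ (A₂-sameSide _) (Aᵢ⊆A₂ (proj₁ (isMin (Fin.suc i)))))
    where
    Aᵢ⊆A₂ : A (Fin.suc i) ⊆ A i₂
    Aᵢ⊆A₂ = descending⇒antitone A descending (≡.subst (ℕ._≤ suc (toℕ i)) (≡.sym i₂≡1) (ℕ.s≤s ℕ.z≤n))

  σu≈c₁ : sumK (λ w → if side w then u w else 0#) ≈ c zero
  σu≈c₁ = trans (sideSum≈χ· side u)
                (trans (·-congʳ σ u≈) (·-dual-coefficient σ c (x ∘ mins) zero σ·min₁ σ·minᵢ))
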